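{- Let $A$ and $B$ be elements of a commutative ring $R$ with identity. For any integer $n>1$, $$\det[v_{|j-k|}(A,B)]_{1\le j,k\le n}=2(1-B)^{n-1}u_n\big(2(1+B),A^2\big)+(4B^2-A^2)(1-B)^{n-2}u_{n-1}\big(2(1+B),A^2\big).$$
   Context: For elements $x,y$ of a commutative ring with identity, the Lucas sequences are defined by $u_0(x,y)=0$, $u_1(x,y)=1$, $v_0(x,y)=2$, $v_1(x,y)=x$, and $u_{n+1}(x,y)=xu_n(x,y)-yu_{n-1}(x,y)$, $v_{n+1}(x,y)=xv_n(x,y)-yv_{n-1}(x,y)$ for $n\ge1$. The convention $0^0=1$ is used. -}

module Defs where

open import Level using (Level)
open import Algebra.Bundles using (CommutativeRing)
open import Data.Nat.Base as ℕ using (ℕ; zero; suc; ∣_-_∣)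
open import Data.Fin.Base as Fin using (Fin; zero; suc; toℕ; punchIn)

module _ {c ℓ : Level} (R : CommutativeRing c ℓ) where
  open CommutativeRing R hiding (zero)

  -- natural-number powers, with x ^ 0 = 1 (so 0^0 = 1, as in the paper)
  pow : Carrier → ℕ → Carrier
  pow x zero    = 1#
  pow x (suc n) = x * pow x n

  lucasU : Carrier → Carrier → ℕ → Carrier
  lucasU x y zero          = 0#
  lucasU x y (suc zero)    = 1#
  lucasU x y (suc (suc n)) = x * lucasU x y (suc n) - y * lucasU x y n

  lucasV : Carrier → Carrier → ℕ → Carrier
  lucasV x y zero          = 1# + 1#
  lucasV x y (suc zero)    = x
  lucasV x y (suc (suc n)) = x * lucasV x y (suc n) - y * lucasV x y n

  sumFin : (n : ℕ) → (Fin n → Carrier) → Carrier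
  sumFin zero    f = 0#
  sumFin (suc n) f = f zero + sumFin n (λ i → f (suc i))

  det : (n : ℕ) → (Fin n → Fin n → Carrier) → Carrier
  det zero    M = 1#
  det (suc n) M =
    sumFin (suc n) (λ k →
      pow (- 1#) (toℕ k) * M Fin.zero k * det n (λ i j → M (suc i) (punchIn k j)))

-- Write V n = v_n(A,B). Adding -A times row 1 and B times row 2 to row 0 of [V |j-k|] leaves
-- (p, A(B-1), 0, …, 0) in row 0 for some p, by the Lucas recurrence. Expanding along row 0
-- expresses the determinant through a determinant of the same kind whose first column is shifted
-- by one; as the determinant is linear in that column and V satisfies its recurrence, the two
-- families of determinants obey a coupled linear recurrence. Eliminating one of them shows that
-- D n = det [V |j-k|] (n × n) satisfies D (n+2) = (1-B)·2(1+B)·D (n+1) - (1-B)²A²·D n for n ≥ 2.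
-- The right-hand side, built from (1-B)^n u_n(2(1+B), A²), obeys the same recurrence, so it
-- suffices to compare the cases n = 2 and n = 3.

module Submission where

open import Level using (Level)
open import Algebra.Bundles using (CommutativeRing)
open import Algebra.Solver.Ring.AlmostCommutativeRing using (fromCommutativeRing; _-Raw-AlmostCommutative⟶_)
import Algebra.Solver.Ring as RingSolver
open import Data.Empty using (⊥-elim)
open import Data.Fin.Base as Fin using (Fin; zero; suc; toℕ; punchIn)
open import Data.Fin.Properties using (suc-injective)
open import Data.Integer.Base as ℤ using (ℤ; +_; -[1+_]; _◃_; _⊖_)
import Data.Integer.Properties as ℤ
open import Data.Maybe.Base as Maybe using ()
open import Data.Nat.Base as ℕ using (ℕ; zero; suc; z≤n; s≤s; _≤_; _∸_; ∣_-_∣)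
import Data.Nat.Properties as ℕ
open import Data.Sign.Base as Sign using (Sign)
open import Data.Vec.Functional using (_∷_; tail)
open import Function.Base using (_∘_)
open import Relation.Binary.Consequences using (dec⇒weaklyDec)
open import Relation.Binary.Definitions using (WeaklyDecidable)
open import Relation.Binary.PropositionalEquality.Core as ≡ using (_≡_; _≢_)

open import Defs

module _ {c ℓ : Level} (R : CommutativeRing c ℓ) where
  open CommutativeRing R hiding (zero)
  open import Algebra.Properties.Ring ring
    using (-‿involutive; -‿distribˡ-*; -‿distribʳ-*; -0#≈0#; -‿anti-homo-+; -‿+-comm; xyx⁻¹≈y; +-inverseˡ-unique)
  open import Algebra.Properties.CommutativeSemigroup *-commutativeSemigroup using (interchange)
  open import Algebra.Properties.Semiring.Mult.TCOptimised semiring using (_×_; 1+×; ×-homo-+; ×1-homo-*)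
  open import Relation.Binary.Reasoning.Setoid setoid

  -- The ring solver needs a coefficient ring with (weakly) decidable equality; we use ℤ via its
  -- initial map into R. The optimised multiple _×_ makes 0 × 1# and 1 × 1# reduce to 0# and 1#,
  -- so that the solver's polynomials evaluate to the very terms occurring in the goals.
  ι : ℤ → Carrier
  ι (+ n)    = n × 1#
  ι -[1+ n ] = - (suc n × 1#)

  ι-neg-+ : ∀ n → ι (ℤ.- + n) ≈ - (n × 1#)
  ι-neg-+ zero    = sym -0#≈0#
  ι-neg-+ (suc n) = refl

  +-cancel-sub : ∀ x a b → (x + a) - (x + b) ≈ a - b
  +-cancel-sub x a b = begin
    (x + a) - (x + b)      ≈⟨ +-congˡ (-‿anti-homo-+ x b) ⟩
    (x + a) + (- b - x)    ≈⟨ +-assoc (x + a) (- b) (- x) ⟨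
    ((x + a) - b) - x      ≈⟨ +-congʳ (+-assoc x a (- b)) ⟩
    x + (a - b) - x        ≈⟨ xyx⁻¹≈y x (a - b) ⟩
    a - b                  ∎

  ι-⊖ : ∀ m n → ι (m ⊖ n) ≈ m × 1# - n × 1#
  ι-⊖ zero    n       = begin
    ι (0 ⊖ n)        ≡⟨ ≡.cong ι (ℤ.⊖-≤ {0} {n} z≤n) ⟩
    ι (ℤ.- + n)      ≈⟨ ι-neg-+ n ⟩
    - (n × 1#)       ≈⟨ +-identityˡ _ ⟨
    0# - n × 1#      ∎
  ι-⊖ (suc m) zero    = begin
    ι (suc m ⊖ 0)        ≡⟨ ≡.cong ι (ℤ.⊖-≥ {suc m} {0} z≤n) ⟩
    suc m × 1#           ≈⟨ +-identityʳ _ ⟨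
    suc m × 1# + 0#      ≈⟨ +-congˡ -0#≈0# ⟨
    suc m × 1# - 0#      ∎
  ι-⊖ (suc m) (suc n) = begin
    ι (suc m ⊖ suc n)               ≡⟨ ≡.cong ι (ℤ.[1+m]⊖[1+n]≡m⊖n m n) ⟩
    ι (m ⊖ n)                       ≈⟨ ι-⊖ m n ⟩
    m × 1# - n × 1#                 ≈⟨ +-cancel-sub 1# (m × 1#) (n × 1#) ⟨
    (1# + m × 1#) - (1# + n × 1#)   ≈⟨ +-cong (1+× m 1#) (-‿cong (1+× n 1#)) ⟨
    suc m × 1# - suc n × 1#         ∎

  ι-+ : ∀ i j → ι (i ℤ.+ j) ≈ ι i + ι j
  ι-+ -[1+ m ] -[1+ n ] = begin
    - (suc (suc (m ℕ.+ n)) × 1#)      ≡⟨ ≡.cong (λ k → - (suc k × 1#)) (ℕ.+-suc m n) ⟨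
    - ((suc m ℕ.+ suc n) × 1#)        ≈⟨ -‿cong (×-homo-+ 1# (suc m) (suc n)) ⟩
    - (suc m × 1# + suc n × 1#)       ≈⟨ -‿+-comm _ _ ⟨
    - (suc m × 1#) - suc n × 1#       ∎
  ι-+ -[1+ m ] (+ n)    = trans (ι-⊖ n (suc m)) (+-comm _ _)
  ι-+ (+ m)    -[1+ n ] = ι-⊖ m (suc n)
  ι-+ (+ m)    (+ n)    = ×-homo-+ 1# m n

  ιˢ : Sign → Carrier
  ιˢ Sign.+ = 1#
  ιˢ Sign.- = - 1#

  ιˢ-* : ∀ s t → ιˢ (s Sign.* t) ≈ ιˢ s * ιˢ t
  ιˢ-* Sign.+ t       = sym (*-identityˡ _)
  ιˢ-* Sign.- Sign.+  = sym (*-identityʳ _)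
  ιˢ-* Sign.- Sign.-  = begin
    1#             ≈⟨ -‿involutive 1# ⟨
    - - 1#         ≈⟨ -‿cong (*-identityʳ _) ⟨
    - (- 1# * 1#)  ≈⟨ -‿distribʳ-* _ _ ⟩
    - 1# * - 1#    ∎

  ι-◃ : ∀ s n → ι (s ◃ n) ≈ ιˢ s * (n × 1#)
  ι-◃ s      zero    = sym (zeroʳ _)
  ι-◃ Sign.+ (suc n) = sym (*-identityˡ _)
  ι-◃ Sign.- (suc n) = trans (-‿cong (sym (*-identityˡ _))) (-‿distribˡ-* _ _)

  ι-signAbs : ∀ i → ι i ≈ ιˢ (ℤ.sign i) * (ℤ.∣ i ∣ × 1#)
  ι-signAbs i = trans (reflexive (≡.cong ι (≡.sym (ℤ.◃-inverse i)))) (ι-◃ (ℤ.sign i) ℤ.∣ i ∣)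

  ι-* : ∀ i j → ι (i ℤ.* j) ≈ ι i * ι j
  ι-* i j = begin
    ι (i ℤ.* j)
      ≈⟨ ι-◃ (ℤ.sign i Sign.* ℤ.sign j) (ℤ.∣ i ∣ ℕ.* ℤ.∣ j ∣) ⟩
    ιˢ (ℤ.sign i Sign.* ℤ.sign j) * ((ℤ.∣ i ∣ ℕ.* ℤ.∣ j ∣) × 1#)
      ≈⟨ *-cong (ιˢ-* (ℤ.sign i) (ℤ.sign j)) (×1-homo-* ℤ.∣ i ∣ ℤ.∣ j ∣) ⟩
    (ιˢ (ℤ.sign i) * ιˢ (ℤ.sign j)) * ((ℤ.∣ i ∣ × 1#) * (ℤ.∣ j ∣ × 1#))
      ≈⟨ interchange _ _ _ _ ⟩
    (ιˢ (ℤ.sign i) * (ℤ.∣ i ∣ × 1#)) * (ιˢ (ℤ.sign j) * (ℤ.∣ j ∣ × 1#))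
      ≈⟨ *-cong (ι-signAbs i) (ι-signAbs j) ⟨
    ι i * ι j ∎

  ι-neg : ∀ i → ι (ℤ.- i) ≈ - ι i
  ι-neg (+ n)    = ι-neg-+ n
  ι-neg -[1+ n ] = sym (-‿involutive _)

  ι-homomorphism : ℤ.+-*-rawRing -Raw-AlmostCommutative⟶ fromCommutativeRing R
  ι-homomorphism = record
    { ⟦_⟧ = ι ; +-homo = ι-+ ; *-homo = ι-* ; -‿homo = ι-neg ; 0-homo = refl ; 1-homo = refl }

  ι-≈? : WeaklyDecidable (λ i j → ι i ≈ ι j)
  ι-≈? i j = Maybe.map (reflexive ∘ ≡.cong ι) (dec⇒weaklyDec ℤ._≟_ i j)

  open RingSolver ℤ.+-*-rawRing (fromCommutativeRing R) ι-homomorphism ι-≈?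
    using (solve; _:=_; _:+_; _:*_; :-_; _:-_; con; Polynomial)

  𝟎 𝟏 : ∀ {k} → Polynomial k
  𝟎 = con (+ 0)
  𝟏 = con (+ 1)

  Matrix : ℕ → Set c
  Matrix n = Fin n → Fin n → Carrier

  sign : ∀ {n} → Fin n → Carrier
  sign k = pow R (- 1#) (toℕ k)

  minor : ∀ {n} → Fin (suc n) → Matrix (suc n) → Matrix n
  minor k M i j = M (suc i) (punchIn k j)

  laplaceTerm : ∀ {n} → Matrix (suc n) → Fin (suc n) → Carrier
  laplaceTerm {n} M k = sign k * M zero k * det R n (minor k M)

  sumFin-cong : ∀ n {f g : Fin n → Carrier} → (∀ i → f i ≈ g i) → sumFin R n f ≈ sumFin R n g
  sumFin-cong zero    f≈g = refl
  sumFin-cong (suc n) f≈g = +-cong (f≈g zero) (sumFin-cong n (f≈g ∘ suc))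

  sumFin-zero : ∀ n {f : Fin n → Carrier} → (∀ i → f i ≈ 0#) → sumFin R n f ≈ 0#
  sumFin-zero zero    f≈0 = refl
  sumFin-zero (suc n) f≈0 = trans (+-cong (f≈0 zero) (sumFin-zero n (f≈0 ∘ suc))) (+-identityˡ 0#)

  *-distribˡ-sumFin : ∀ n a (f : Fin n → Carrier) → a * sumFin R n f ≈ sumFin R n (λ i → a * f i)
  *-distribˡ-sumFin zero    a f = zeroʳ a
  *-distribˡ-sumFin (suc n) a f = trans (distribˡ a _ _) (+-congˡ (*-distribˡ-sumFin n a (f ∘ suc)))

  sumFin-+ : ∀ n (f g : Fin n → Carrier) → sumFin R n (λ i → f i + g i) ≈ sumFin R n f + sumFin R n g
  sumFin-+ zero    f g = sym (+-identityˡ 0#)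
  sumFin-+ (suc n) f g = trans (+-congˡ (sumFin-+ n (f ∘ suc) (g ∘ suc)))
    (solve 4 (λ a b x y → (a :+ b) :+ (x :+ y) := (a :+ x) :+ (b :+ y)) refl _ _ _ _)

  sumFin-linear : ∀ n α β (f g : Fin n → Carrier) →
    sumFin R n (λ i → α * f i + β * g i) ≈ α * sumFin R n f + β * sumFin R n g
  sumFin-linear n α β f g = trans (sumFin-+ n _ _)
    (sym (+-cong (*-distribˡ-sumFin n α f) (*-distribˡ-sumFin n β g)))

  det-cong : ∀ n {M N : Matrix n} → (∀ i j → M i j ≈ N i j) → det R n M ≈ det R n N
  det-cong zero    M≈N = refl
  det-cong (suc n) M≈N = sumFin-cong (suc n) λ k →
    *-cong (*-congˡ {sign k} (M≈N zero k)) (det-cong n λ i j → M≈N (suc i) (punchIn k j))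

  laplaceTerm-linear-entry : ∀ s α β a b {d d₁ d₂} → d ≈ d₁ → d ≈ d₂ →
    s * (α * a + β * b) * d ≈ α * (s * a * d₁) + β * (s * b * d₂)
  laplaceTerm-linear-entry s α β a b {d} d≈d₁ d≈d₂ = begin
    s * (α * a + β * b) * d
      ≈⟨ solve 6 (λ s α β a b d → s :* (α :* a :+ β :* b) :* d := α :* (s :* a :* d) :+ β :* (s :* b :* d))
           refl s α β a b d ⟩
    α * (s * a * d) + β * (s * b * d)
      ≈⟨ +-cong (*-congˡ (*-congˡ d≈d₁)) (*-congˡ (*-congˡ d≈d₂)) ⟩
    _ ∎

  laplaceTerm-linear-minor : ∀ s α β {m m₁ m₂ d d₁ d₂} → m ≈ m₁ → m ≈ m₂ → d ≈ α * d₁ + β * d₂ →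
    s * m * d ≈ α * (s * m₁ * d₁) + β * (s * m₂ * d₂)
  laplaceTerm-linear-minor s α β {m = m} {d = d} {d₁ = d₁} {d₂ = d₂} m≈m₁ m≈m₂ d≈ = begin
    s * m * d
      ≈⟨ *-congˡ d≈ ⟩
    s * m * (α * d₁ + β * d₂)
      ≈⟨ solve 6 (λ s α β m d₁ d₂ → s :* m :* (α :* d₁ :+ β :* d₂) := α :* (s :* m :* d₁) :+ β :* (s :* m :* d₂))
           refl s α β m d₁ d₂ ⟩
    α * (s * m * d₁) + β * (s * m * d₂)
      ≈⟨ +-cong (*-congˡ (*-congʳ (*-congˡ m≈m₁))) (*-congˡ (*-congʳ (*-congˡ m≈m₂))) ⟩
    _ ∎

  det-linear-row : ∀ n (p : Fin n) (M M₁ M₂ : Matrix n) α β →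
    (∀ i → i ≢ p → ∀ j → M i j ≈ M₁ i j) → (∀ i → i ≢ p → ∀ j → M i j ≈ M₂ i j) →
    (∀ j → M p j ≈ α * M₁ p j + β * M₂ p j) →
    det R n M ≈ α * det R n M₁ + β * det R n M₂
  det-linear-row (suc n) zero M M₁ M₂ α β M≈M₁ M≈M₂ row₀ =
    trans (sumFin-cong (suc n) term) (sumFin-linear (suc n) α β (laplaceTerm M₁) (laplaceTerm M₂))
    where
    term : ∀ k → laplaceTerm M k ≈ α * laplaceTerm M₁ k + β * laplaceTerm M₂ k
    term k = trans (*-congʳ (*-congˡ (row₀ k)))
      (laplaceTerm-linear-entry (sign k) α β _ _
        (det-cong n λ i j → M≈M₁ (suc i) (λ ()) (punchIn k j))
        (det-cong n λ i j → M≈M₂ (suc i) (λ ()) (punchIn k j)))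
  det-linear-row (suc n) (suc p) M M₁ M₂ α β M≈M₁ M≈M₂ row-p =
    trans (sumFin-cong (suc n) term) (sumFin-linear (suc n) α β (laplaceTerm M₁) (laplaceTerm M₂))
    where
    term : ∀ k → laplaceTerm M k ≈ α * laplaceTerm M₁ k + β * laplaceTerm M₂ k
    term k = laplaceTerm-linear-minor (sign k) α β (M≈M₁ zero (λ ()) k) (M≈M₂ zero (λ ()) k)
      (det-linear-row n p (minor k M) (minor k M₁) (minor k M₂) α β
        (λ i i≢p j → M≈M₁ (suc i) (i≢p ∘ suc-injective) (punchIn k j))
        (λ i i≢p j → M≈M₂ (suc i) (i≢p ∘ suc-injective) (punchIn k j))
        (row-p ∘ punchIn k))

  det-linear-column₀ : ∀ n (M M₁ M₂ : Matrix (suc n)) α β →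
    (∀ i j → M i (suc j) ≈ M₁ i (suc j)) → (∀ i j → M i (suc j) ≈ M₂ i (suc j)) →
    (∀ i → M i zero ≈ α * M₁ i zero + β * M₂ i zero) →
    det R (suc n) M ≈ α * det R (suc n) M₁ + β * det R (suc n) M₂
  det-linear-column₀ zero M M₁ M₂ α β M≈M₁ M≈M₂ column₀ =
    trans (sumFin-cong 1 term) (sumFin-linear 1 α β (laplaceTerm M₁) (laplaceTerm M₂))
    where
    term : ∀ k → laplaceTerm M k ≈ α * laplaceTerm M₁ k + β * laplaceTerm M₂ k
    term zero = trans (*-congʳ (*-congˡ (column₀ zero))) (laplaceTerm-linear-entry 1# α β _ _ refl refl)
  det-linear-column₀ (suc n) M M₁ M₂ α β M≈M₁ M≈M₂ column₀ =
    trans (sumFin-cong (suc (suc n)) term) (sumFin-linear (suc (suc n)) α β (laplaceTerm M₁) (laplaceTerm M₂))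
    where
    term : ∀ k → laplaceTerm M k ≈ α * laplaceTerm M₁ k + β * laplaceTerm M₂ k
    term zero    = trans (*-congʳ (*-congˡ (column₀ zero))) (laplaceTerm-linear-entry 1# α β _ _
      (det-cong (suc n) λ i j → M≈M₁ (suc i) j) (det-cong (suc n) λ i j → M≈M₂ (suc i) j))
    term (suc k) = laplaceTerm-linear-minor (sign (suc k)) α β (M≈M₁ zero k) (M≈M₂ zero k)
      (det-linear-column₀ n (minor (suc k) M) (minor (suc k) M₁) (minor (suc k) M₂) α β
        (λ i j → M≈M₁ (suc i) (punchIn k j)) (λ i j → M≈M₂ (suc i) (punchIn k j)) (column₀ ∘ suc))

  Extensional : ∀ {m n} → ((Fin m → Fin n) → Carrier) → Set ℓ
  Extensional C = ∀ {f g} → (∀ j → f j ≡ g j) → C f ≈ C g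

  -- Expansion of a determinant along rows 0 and 1, both equal to r; C maps the remaining column
  -- indices to the complementary minor.
  pairExpansion : ∀ m → (Fin (suc (suc m)) → Carrier) → ((Fin m → Fin (suc (suc m))) → Carrier) → Carrier
  pairExpansion m r C = sumFin R (suc (suc m)) λ k → sign k * r k *
    sumFin R (suc m) λ l → sign l * r (punchIn k l) * C (punchIn k ∘ punchIn l)

  offDiagonal : ∀ m → (Fin (suc (suc m)) → Carrier) → ((Fin m → Fin (suc (suc m))) → Carrier) → Carrier
  offDiagonal m r C = sumFin R (suc m) λ k → sign (suc k) * r (suc k) *
    sumFin R m λ l → sign (suc l) * r (suc (punchIn k l)) * C (punchIn (suc k) ∘ punchIn (suc l))

  -- The terms with k = 0 or l = 0 cancel in pairs: (0, k+1) against (k+1, 0).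
  pairExpansion≈offDiagonal : ∀ m r C → pairExpansion m r C ≈ offDiagonal m r C
  pairExpansion≈offDiagonal m r C = begin
    pairExpansion m r C
      ≈⟨ +-congˡ (sumFin-cong (suc m) split) ⟩
    1# * r zero * S + sumFin R (suc m) (λ k → - r zero * G k + 1# * H k)
      ≈⟨ +-congˡ (sumFin-linear (suc m) (- r zero) 1# G H) ⟩
    1# * r zero * S + (- r zero * S + 1# * offDiagonal m r C)
      ≈⟨ solve 3 (λ a s o → 𝟏 :* a :* s :+ (:- a :* s :+ 𝟏 :* o) := o) refl (r zero) S _ ⟩
    offDiagonal m r C ∎
    where
    E : Fin (suc m) → Carrier
    E k = C (λ j → suc (punchIn k j))
    G : Fin (suc m) → Carrier
    G k = sign k * r (suc k) * E k
    S : Carrier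
    S = sumFin R (suc m) G
    O : Fin (suc m) → Carrier
    O k = sumFin R m λ l → sign (suc l) * r (suc (punchIn k l)) * C (punchIn (suc k) ∘ punchIn (suc l))
    H : Fin (suc m) → Carrier
    H k = sign (suc k) * r (suc k) * O k
    split : ∀ k → sign (suc k) * r (suc k) * (1# * r zero * E k + O k) ≈ - r zero * G k + 1# * H k
    split k = solve 5 (λ s a r₀ e o → (:- 𝟏 :* s) :* a :* (𝟏 :* r₀ :* e :+ o)
                                    := :- r₀ :* (s :* a :* e) :+ 𝟏 :* ((:- 𝟏 :* s) :* a :* o))
                refl (sign k) (r (suc k)) (r zero) (E k) (O k)

  offDiagonal-zero : ∀ r C → offDiagonal zero r C ≈ 0#
  offDiagonal-zero r C = sumFin-zero 1 λ k → zeroʳ (sign (suc k) * r (suc k))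

  offDiagonal-suc : ∀ m r C → Extensional C →
    offDiagonal (suc m) r C ≈ pairExpansion m (r ∘ suc) (C ∘ Fin.lift 1)
  offDiagonal-suc m r C C-ext = sumFin-cong (suc (suc m)) λ k → begin
    sign (suc k) * r (suc k) * sumFin R (suc m) (O k)
      ≈⟨ *-congˡ (sumFin-cong (suc m) λ l → inner k l) ⟩
    sign (suc k) * r (suc k) * sumFin R (suc m) (λ l → - 1# * T k l)
      ≈⟨ *-congˡ (*-distribˡ-sumFin (suc m) (- 1#) (T k)) ⟨
    sign (suc k) * r (suc k) * (- 1# * sumFin R (suc m) (T k))
      ≈⟨ solve 3 (λ s a t → (:- 𝟏 :* s) :* a :* (:- 𝟏 :* t) := s :* a :* t) refl (sign k) (r (suc k)) _ ⟩
    sign k * r (suc k) * sumFin R (suc m) (T k) ∎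
    where
    O T : Fin (suc (suc m)) → Fin (suc m) → Carrier
    O k l = sign (suc l) * r (suc (punchIn k l)) * C (punchIn (suc k) ∘ punchIn (suc l))
    T k l = sign l * r (suc (punchIn k l)) * C (Fin.lift 1 (punchIn k ∘ punchIn l))
    punchIn-lift : ∀ k l j → punchIn (suc k) (punchIn (suc l) j) ≡ Fin.lift 1 (punchIn k ∘ punchIn l) j
    punchIn-lift k l zero    = ≡.refl
    punchIn-lift k l (suc j) = ≡.refl
    inner : ∀ k l → O k l ≈ - 1# * T k l
    inner k l = trans (*-congˡ (C-ext (punchIn-lift k l)))
      (solve 3 (λ s a x → (:- 𝟏 :* s) :* a :* x := :- 𝟏 :* (s :* a :* x)) refl (sign l) _ _)

  pairExpansion-vanishes : ∀ m r C → Extensional C → pairExpansion m r C ≈ 0#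
  pairExpansion-vanishes zero    r C C-ext = trans (pairExpansion≈offDiagonal zero r C) (offDiagonal-zero r C)
  pairExpansion-vanishes (suc m) r C C-ext = begin
    pairExpansion (suc m) r C                       ≈⟨ pairExpansion≈offDiagonal (suc m) r C ⟩
    offDiagonal (suc m) r C                         ≈⟨ offDiagonal-suc m r C C-ext ⟩
    pairExpansion m (r ∘ suc) (C ∘ Fin.lift 1)      ≈⟨ pairExpansion-vanishes m (r ∘ suc) (C ∘ Fin.lift 1) lift-ext ⟩
    0#                                              ∎
    where
    lift-ext : Extensional (C ∘ Fin.lift 1)
    lift-ext f≗g = C-ext λ { zero → ≡.refl ; (suc j) → ≡.cong suc (f≗g j) }

  det-equal-rows₀₁ : ∀ n (M : Matrix (suc (suc n))) → (∀ j → M zero j ≈ M (suc zero) j) → det R (suc (suc n)) M ≈ 0#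
  det-equal-rows₀₁ n M rows = begin
    det R (suc (suc n)) M
      ≈⟨ sumFin-cong (suc (suc n)) (λ k → *-congˡ {sign k * M zero k} (sumFin-cong (suc n) λ l →
           *-congʳ {C (punchIn k ∘ punchIn l)} (*-congˡ {sign l} (sym (rows (punchIn k l)))))) ⟩
    pairExpansion n (M zero) C
      ≈⟨ pairExpansion-vanishes n (M zero) C C-ext ⟩
    0# ∎
    where
    C : (Fin n → Fin (suc (suc n))) → Carrier
    C f = det R n λ i j → M (suc (suc i)) (f j)
    C-ext : Extensional C
    C-ext f≗g = det-cong n λ i j → reflexive (≡.cong (M (suc (suc i))) (f≗g j))

  det-equal-rows₁₂ : ∀ n (M : Matrix (suc (suc (suc n)))) → (∀ j → M (suc zero) j ≈ M (suc (suc zero)) j) →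
    det R (suc (suc (suc n))) M ≈ 0#
  det-equal-rows₁₂ n M rows = sumFin-zero (suc (suc (suc n))) λ k →
    trans (*-congˡ {sign k * M zero k} (det-equal-rows₀₁ n (minor k M) (rows ∘ punchIn k))) (zeroʳ _)

  -- Polarisation: the determinant with rows 1 and 2 both equal to x + y vanishes.
  det-swap-rows₁₂ : ∀ n (r x y : Fin (suc (suc (suc n))) → Carrier) (N : Fin n → Fin (suc (suc (suc n))) → Carrier) →
    det R (suc (suc (suc n))) (r ∷ x ∷ y ∷ N) + det R (suc (suc (suc n))) (r ∷ y ∷ x ∷ N) ≈ 0#
  det-swap-rows₁₂ n r x y N = sym (begin
    0#
      ≈⟨ diagonal s ⟨
    D s s
      ≈⟨ row₁-linear s ⟩
    1# * D x s + 1# * D y s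
      ≈⟨ +-cong (*-congˡ (row₂-linear x)) (*-congˡ (row₂-linear y)) ⟩
    1# * (1# * D x x + 1# * D x y) + 1# * (1# * D y x + 1# * D y y)
      ≈⟨ +-cong (*-congˡ (+-congʳ (*-congˡ (diagonal x)))) (*-congˡ (+-congˡ (*-congˡ (diagonal y)))) ⟩
    1# * (1# * 0# + 1# * D x y) + 1# * (1# * D y x + 1# * 0#)
      ≈⟨ solve 2 (λ a b → 𝟏 :* (𝟏 :* 𝟎 :+ 𝟏 :* a) :+ 𝟏 :* (𝟏 :* b :+ 𝟏 :* 𝟎) := a :+ b) refl _ _ ⟩
    D x y + D y x ∎)
    where
    N₃ : ℕ
    N₃ = suc (suc (suc n))
    D : (u v : Fin N₃ → Carrier) → Carrier
    D u v = det R N₃ (r ∷ u ∷ v ∷ N)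
    s : Fin N₃ → Carrier
    s j = x j + y j
    sum≈ : ∀ j → s j ≈ 1# * x j + 1# * y j
    sum≈ j = sym (+-cong (*-identityˡ _) (*-identityˡ _))
    off-row₁ : ∀ {u v w : Fin N₃ → Carrier} i → i ≢ suc zero →
      ∀ j → (r ∷ u ∷ w ∷ N) i j ≈ (r ∷ v ∷ w ∷ N) i j
    off-row₁ zero             _   _ = refl
    off-row₁ (suc zero)       i≢1 _ = ⊥-elim (i≢1 ≡.refl)
    off-row₁ (suc (suc i))    _   _ = refl
    off-row₂ : ∀ {u v w : Fin N₃ → Carrier} i → i ≢ suc (suc zero) →
      ∀ j → (r ∷ w ∷ u ∷ N) i j ≈ (r ∷ w ∷ v ∷ N) i j
    off-row₂ zero                _   _ = refl
    off-row₂ (suc zero)          _   _ = refl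
    off-row₂ (suc (suc zero))    i≢2 _ = ⊥-elim (i≢2 ≡.refl)
    off-row₂ (suc (suc (suc i))) _   _ = refl
    diagonal : ∀ u → D u u ≈ 0#
    diagonal u = det-equal-rows₁₂ n (r ∷ u ∷ u ∷ N) (λ _ → refl)
    row₁-linear : ∀ v → D s v ≈ 1# * D x v + 1# * D y v
    row₁-linear v = det-linear-row N₃ (suc zero) (r ∷ s ∷ v ∷ N) (r ∷ x ∷ v ∷ N) (r ∷ y ∷ v ∷ N) 1# 1#
      off-row₁ off-row₁ sum≈
    row₂-linear : ∀ u → D u s ≈ 1# * D u x + 1# * D u y
    row₂-linear u = det-linear-row N₃ (suc (suc zero)) (r ∷ u ∷ s ∷ N) (r ∷ u ∷ x ∷ N) (r ∷ u ∷ y ∷ N) 1# 1#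
      off-row₂ off-row₂ sum≈

  det-equal-rows₀₂ : ∀ n (M : Matrix (suc (suc (suc n)))) → (∀ j → M zero j ≈ M (suc (suc zero)) j) →
    det R (suc (suc (suc n))) M ≈ 0#
  det-equal-rows₀₂ n M rows = begin
    det R N₃ M                        ≈⟨ det-cong N₃ M≈rows ⟩
    det R N₃ (M₀ ∷ M₁ ∷ M₂ ∷ N)        ≈⟨ +-inverseˡ-unique _ _ (det-swap-rows₁₂ n M₀ M₁ M₂ N) ⟩
    - det R N₃ (M₀ ∷ M₂ ∷ M₁ ∷ N)      ≈⟨ -‿cong (det-equal-rows₀₁ (suc n) (M₀ ∷ M₂ ∷ M₁ ∷ N) rows) ⟩
    - 0#                              ≈⟨ -0#≈0# ⟩
    0#                                ∎
    where
    N₃ : ℕ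
    N₃ = suc (suc (suc n))
    M₀ M₁ M₂ : Fin N₃ → Carrier
    M₀ = M zero
    M₁ = M (suc zero)
    M₂ = M (suc (suc zero))
    N : Fin n → Fin N₃ → Carrier
    N = tail (tail (tail M))
    M≈rows : ∀ i j → M i j ≈ (M₀ ∷ M₁ ∷ M₂ ∷ N) i j
    M≈rows zero                _ = refl
    M≈rows (suc zero)          _ = refl
    M≈rows (suc (suc zero))    _ = refl
    M≈rows (suc (suc (suc i))) _ = refl

  det-row-operation : ∀ n (M : Matrix (suc (suc (suc n)))) a b (w : Fin (suc (suc (suc n))) → Carrier) →
    (∀ j → w j ≈ M zero j + a * M (suc zero) j + b * M (suc (suc zero)) j) →
    det R (suc (suc (suc n))) (w ∷ tail M) ≈ det R (suc (suc (suc n))) M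
  det-row-operation n M a b w w≈ = begin
    det R N₃ (w ∷ tail M)
      ≈⟨ det-linear-row N₃ zero (w ∷ tail M) (u ∷ tail M) (M₂ ∷ tail M) 1# b off-row₀ off-row₀
           (λ j → trans (w≈ j) (+-congʳ {b * M₂ j} (sym (*-identityˡ _)))) ⟩
    1# * det R N₃ (u ∷ tail M) + b * det R N₃ (M₂ ∷ tail M)
      ≈⟨ +-cong (*-congˡ (det-linear-row N₃ zero (u ∷ tail M) (M₀ ∷ tail M) (M₁ ∷ tail M) 1# a off-row₀ off-row₀
                            (λ j → +-congʳ (sym (*-identityˡ _)))))
                (*-congˡ (det-equal-rows₀₂ n (M₂ ∷ tail M) (λ j → refl))) ⟩
    1# * (1# * det R N₃ M + a * det R N₃ (M₁ ∷ tail M)) + b * 0#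
      ≈⟨ +-congʳ (*-congˡ (+-congˡ (*-congˡ (det-equal-rows₀₁ (suc n) (M₁ ∷ tail M) (λ j → refl))))) ⟩
    1# * (1# * det R N₃ M + a * 0#) + b * 0#
      ≈⟨ solve 3 (λ d a b → 𝟏 :* (𝟏 :* d :+ a :* 𝟎) :+ b :* 𝟎 := d) refl _ a b ⟩
    det R N₃ M ∎
    where
    N₃ : ℕ
    N₃ = suc (suc (suc n))
    M₀ M₁ M₂ u : Fin N₃ → Carrier
    M₀ = M zero
    M₁ = M (suc zero)
    M₂ = M (suc (suc zero))
    u j = M₀ j + a * M₁ j
    off-row₀ : ∀ {v v′ : Fin N₃ → Carrier} i → i ≢ zero → ∀ j → (v ∷ tail M) i j ≈ (v′ ∷ tail M) i j
    off-row₀ zero    i≢0 _ = ⊥-elim (i≢0 ≡.refl)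
    off-row₀ (suc i) _   _ = refl

  -- The left-hand polynomial is the literal unfolding of det R 2 M.
  det₂ : (M : Matrix 2) → det R 2 M ≈ M zero zero * M (suc zero) (suc zero) - M zero (suc zero) * M (suc zero) zero
  det₂ M = solve 4 (λ a b c d → 𝟏 :* a :* (𝟏 :* d :* 𝟏 :+ 𝟎)
                     :+ ((:- 𝟏 :* 𝟏) :* b :* (𝟏 :* c :* 𝟏 :+ 𝟎) :+ 𝟎)
                     := a :* d :- b :* c)
    refl (M zero zero) (M zero (suc zero)) (M (suc zero) zero) (M (suc zero) (suc zero))

  LucasRecurrence : Carrier → Carrier → (ℕ → Carrier) → Set ℓ
  LucasRecurrence x y s = ∀ n → s (suc (suc n)) ≈ x * s (suc n) - y * s n

  recurrence-unique : ∀ {x y s s′} → LucasRecurrence x y s → LucasRecurrence x y s′ →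
    s 0 ≈ s′ 0 → s 1 ≈ s′ 1 → ∀ n → s n ≈ s′ n
  recurrence-unique rec rec′ s₀ s₁ zero          = s₀
  recurrence-unique rec rec′ s₀ s₁ (suc zero)    = s₁
  recurrence-unique {s = s} {s′} rec rec′ s₀ s₁ (suc (suc n)) =
    trans (rec n) (trans (+-cong (*-congˡ (agree (suc n))) (-‿cong (*-congˡ (agree n)))) (sym (rec′ n)))
    where
    agree : ∀ m → s m ≈ s′ m
    agree = recurrence-unique rec rec′ s₀ s₁

  recurrence-scale : ∀ {x y s} w → LucasRecurrence x y s → LucasRecurrence (w * x) (w * w * y) (λ n → pow R w n * s n)
  recurrence-scale {x} {y} {s} w rec n = trans (*-congˡ (rec n))
    (solve 6 (λ w x y p s₀ s₁ → w :* (w :* p) :* (x :* s₁ :- y :* s₀)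
                              := w :* x :* (w :* p :* s₁) :- w :* w :* y :* (p :* s₀))
       refl w x y (pow R w n) (s n) (s (suc n)))

  recurrence-combine : ∀ {x y s} α β → LucasRecurrence x y s → LucasRecurrence x y (λ n → α * s (suc n) + β * s n)
  recurrence-combine {x} {y} {s} α β rec n = trans (+-cong (*-congˡ (rec (suc n))) (*-congˡ (rec n)))
    (solve 7 (λ α β x y s₀ s₁ s₂ → α :* (x :* s₂ :- y :* s₁) :+ β :* (x :* s₁ :- y :* s₀)
                                  := x :* (α :* s₂ :+ β :* s₁) :- y :* (α :* s₁ :+ β :* s₀))
       refl α β x y (s n) (s (suc n)) (s (suc (suc n))))

  -- Polynomial counterparts of lucasU/lucasV and pow, evaluating to exactly those terms, so that
  -- the solver applies to goals mentioning Lucas values of small index.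
  lucasₚ : ∀ {k} → (v₀ v₁ x y : Polynomial k) → ℕ → Polynomial k
  lucasₚ v₀ v₁ x y zero          = v₀
  lucasₚ v₀ v₁ x y (suc zero)    = v₁
  lucasₚ v₀ v₁ x y (suc (suc n)) = x :* lucasₚ v₀ v₁ x y (suc n) :- y :* lucasₚ v₀ v₁ x y n

  powₚ : ∀ {k} → Polynomial k → ℕ → Polynomial k
  powₚ p zero    = 𝟏
  powₚ p (suc n) = p :* powₚ p n

  module LucasToeplitz (A B : Carrier) where

    V : ℕ → Carrier
    V = lucasV R A B

    toeplitz : (n : ℕ) → Matrix n
    toeplitz n i j = V ∣ toℕ i - toℕ j ∣

    toeplitzWithColumn₀ : (ℕ → Carrier) → (m : ℕ) → Matrix (suc m)
    toeplitzWithColumn₀ a m i       zero    = a (toℕ i)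
    toeplitzWithColumn₀ a m zero    (suc j) = V (suc (toℕ j))
    toeplitzWithColumn₀ a m (suc i) (suc j) = V ∣ toℕ i - toℕ j ∣

    Δ : (ℕ → Carrier) → ℕ → Carrier
    Δ a m = det R (suc m) (toeplitzWithColumn₀ a m)

    det-toeplitz≈Δ : ∀ m → det R (suc m) (toeplitz (suc m)) ≈ Δ V m
    det-toeplitz≈Δ m = det-cong (suc m) {toeplitz (suc m)} {toeplitzWithColumn₀ V m} λ where
      zero    zero    → refl
      (suc i) zero    → refl
      zero    (suc j) → refl
      (suc i) (suc j) → refl

    κ : Carrier
    κ = A * (B - 1#)

    pivot : (ℕ → Carrier) → Carrier
    pivot a = a 0 - A * a 1 + B * a 2

    -- Row 0 minus A times row 1 plus B times row 2 is (pivot a, κ, 0, …, 0): V₀ = 2 and V₁ = A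
    -- give κ, and the Lucas recurrence kills the remaining entries.
    Δ-expand : ∀ k a → Δ a (suc (suc k)) ≈ pivot a * Δ V (suc k) - κ * Δ (a ∘ suc) (suc k)
    Δ-expand k a = begin
      det R N₃ M
        ≈⟨ det-row-operation k M (- A) B W W≈ ⟨
      det R N₃ (W ∷ tail M)
        ≈⟨ +-congˡ (+-congˡ (sumFin-zero (suc k) vanishing)) ⟩
      1# * e * det R N₂ (minor zero M) + ((- 1# * 1#) * κ * det R N₂ (minor (suc zero) M) + 0#)
        ≈⟨ +-cong (*-congˡ (det-toeplitz≈Δ (suc k))) (+-congʳ (*-congˡ (det-cong N₂ minor₁))) ⟩
      1# * e * Δ V (suc k) + ((- 1# * 1#) * κ * Δ (a ∘ suc) (suc k) + 0#)
        ≈⟨ solve 4 (λ e x κ y → 𝟏 :* e :* x :+ ((:- 𝟏 :* 𝟏) :* κ :* y :+ 𝟎)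
                               := e :* x :- κ :* y) refl e _ κ _ ⟩
      e * Δ V (suc k) - κ * Δ (a ∘ suc) (suc k) ∎
      where
      N₂ N₃ : ℕ
      N₂ = suc (suc k)
      N₃ = suc N₂
      M : Matrix N₃
      M = toeplitzWithColumn₀ a N₂
      e : Carrier
      e = pivot a
      W : Fin N₃ → Carrier
      W zero          = e
      W (suc zero)    = κ
      W (suc (suc j)) = 0#
      W≈ : ∀ j → W j ≈ M zero j + - A * M (suc zero) j + B * M (suc (suc zero)) j
      W≈ zero          = solve 5 (λ a₀ a₁ a₂ A B → a₀ :- A :* a₁ :+ B :* a₂ := a₀ :+ :- A :* a₁ :+ B :* a₂)
                           refl (a 0) (a 1) (a 2) A B
      W≈ (suc zero)    = solve 2 (λ A B → A :* (B :- 𝟏) := A :+ :- A :* (𝟏 :+ 𝟏) :+ B :* A)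
                           refl A B
      W≈ (suc (suc j)) = solve 4 (λ A B x y → 𝟎 := (A :* x :- B :* y) :+ :- A :* x :+ B :* y)
                           refl A B (V (suc (toℕ j))) (V (toℕ j))
      vanishing : ∀ (j : Fin (suc k)) → laplaceTerm (W ∷ tail M) (suc (suc j)) ≈ 0#
      vanishing j = trans (*-congʳ (zeroʳ _)) (zeroˡ _)
      minor₁ : ∀ i j → minor (suc zero) M i j ≈ toeplitzWithColumn₀ (a ∘ suc) (suc k) i j
      minor₁ i       zero    = refl
      minor₁ zero    (suc j) = refl
      minor₁ (suc i) (suc j) = refl

    Δ-linear : ∀ m (a b e : ℕ → Carrier) α β → (∀ r → a r ≈ α * b r + β * e r) → Δ a m ≈ α * Δ b m + β * Δ e m
    Δ-linear m a b e α β a≈ =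
      det-linear-column₀ m (toeplitzWithColumn₀ a m) (toeplitzWithColumn₀ b m) (toeplitzWithColumn₀ e m) α β
        same same (a≈ ∘ toℕ)
      where
      same : ∀ {c c′} i j → toeplitzWithColumn₀ c m i (suc j) ≈ toeplitzWithColumn₀ c′ m i (suc j)
      same zero    j = refl
      same (suc i) j = refl

    w x y e₄ : Carrier
    w  = 1# - B
    x  = (1# + 1#) * (1# + B)
    y  = A * A
    e₄ = (1# + 1# + 1# + 1#) * (B * B) - A * A

    H : ℕ → Carrier
    H n = pow R w n * lucasU R x y (suc n)

    F : ℕ → Carrier
    F k = (1# + 1#) * H (suc k) + e₄ * H k

    F-recurrence : LucasRecurrence (w * x) (w * w * y) F
    F-recurrence = recurrence-combine (1# + 1#) e₄ (recurrence-scale w λ _ → refl)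

    Vₚ : ∀ {k} → Polynomial k → Polynomial k → ℕ → Polynomial k
    Vₚ a b = lucasₚ (𝟏 :+ 𝟏) a a b

    κₚ wₚ xₚ yₚ e₄ₚ : ∀ {k} → Polynomial k → Polynomial k → Polynomial k
    κₚ  a b = a :* (b :- 𝟏)
    wₚ  a b = 𝟏 :- b
    xₚ  a b = (𝟏 :+ 𝟏) :* (𝟏 :+ b)
    yₚ  a b = a :* a
    e₄ₚ a b = (𝟏 :+ 𝟏 :+ 𝟏 :+ 𝟏) :* (b :* b) :- a :* a

    Hₚ : ∀ {k} → Polynomial k → Polynomial k → ℕ → Polynomial k
    Hₚ a b n = powₚ (wₚ a b) n :* lucasₚ 𝟎 𝟏 (xₚ a b) (yₚ a b) (suc n)

    Fₚ : ∀ {k} → Polynomial k → Polynomial k → ℕ → Polynomial k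
    Fₚ a b n = (𝟏 :+ 𝟏) :* Hₚ a b (suc n) :+ e₄ₚ a b :* Hₚ a b n

    pₚ qₚ : ∀ {k} → Polynomial k → Polynomial k → Polynomial k
    pₚ a b = Vₚ a b 0 :- a :* Vₚ a b 1 :+ b :* Vₚ a b 2
    qₚ a b = Vₚ a b 1 :- a :* Vₚ a b 2 :+ b :* Vₚ a b 3

    -- Y is eliminated through κ · Y k = p · X k - X (suc k).
    Δ-recurrence : LucasRecurrence (w * x) (w * w * y) (λ k → Δ V (suc k))
    Δ-recurrence k = begin
      X (suc (suc k))
        ≈⟨ Δ-expand (suc k) V ⟩
      p * X (suc k) - κ * Y (suc k)
        ≈⟨ +-congˡ (-‿cong (*-congˡ Y-step)) ⟩
      p * X (suc k) - κ * (q * X k - κ * (A * Y k + - B * X k))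
        ≈⟨ +-congʳ (*-congˡ (Δ-expand k V)) ⟩
      p * (p * X k - κ * Y k) - κ * (q * X k - κ * (A * Y k + - B * X k))
        ≈⟨ solve 4 (λ a b X Y → pₚ a b :* (pₚ a b :* X :- κₚ a b :* Y)
                                 :- κₚ a b :* (qₚ a b :* X :- κₚ a b :* (a :* Y :+ :- b :* X))
                               := wₚ a b :* xₚ a b :* (pₚ a b :* X :- κₚ a b :* Y)
                                 :- wₚ a b :* wₚ a b :* yₚ a b :* X)
             refl A B (X k) (Y k) ⟩
      w * x * (p * X k - κ * Y k) - w * w * y * X k
        ≈⟨ +-congʳ (*-congˡ (Δ-expand k V)) ⟨
      w * x * X (suc k) - w * w * y * X k ∎
      where
      X Y : ℕ → Carrier
      X k = Δ V (suc k)
      Y k = Δ (V ∘ ℕ.suc) (suc k)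
      p q : Carrier
      p = pivot V
      q = pivot (V ∘ ℕ.suc)
      Y-step : Y (suc k) ≈ q * X k - κ * (A * Y k + - B * X k)
      Y-step = trans (Δ-expand k (V ∘ ℕ.suc)) (+-congˡ (-‿cong (*-congˡ
        (Δ-linear (suc k) (V ∘ ℕ.suc ∘ ℕ.suc) (V ∘ ℕ.suc) V A (- B) λ r → +-congˡ (-‿distribˡ-* B (V r))))))

    Δ₁ : Δ V 1 ≈ F 0
    Δ₁ = trans (det₂ (toeplitzWithColumn₀ V 1))
      (solve 2 (λ a b → Vₚ a b 0 :* Vₚ a b 0 :- Vₚ a b 1 :* Vₚ a b 1 := Fₚ a b 0) refl A B)

    Δ₂ : Δ V 2 ≈ F 1
    Δ₂ = begin
      Δ V 2
        ≈⟨ Δ-expand 0 V ⟩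
      p * Δ V 1 - κ * Δ (V ∘ ℕ.suc) 1
        ≈⟨ +-cong (*-congˡ (det₂ (toeplitzWithColumn₀ V 1)))
                  (-‿cong (*-congˡ (det₂ (toeplitzWithColumn₀ (V ∘ ℕ.suc) 1)))) ⟩
      p * (V 0 * V 0 - V 1 * V 1) - κ * (V 1 * V 0 - V 1 * V 2)
        ≈⟨ solve 2 (λ a b → pₚ a b :* (Vₚ a b 0 :* Vₚ a b 0 :- Vₚ a b 1 :* Vₚ a b 1)
                             :- κₚ a b :* (Vₚ a b 1 :* Vₚ a b 0 :- Vₚ a b 1 :* Vₚ a b 2) := Fₚ a b 1) refl A B ⟩
      F 1 ∎
      where
      p : Carrier
      p = pivot V

corollary1p3 : {c ℓ : Level} (R : CommutativeRing c ℓ) →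
    let open CommutativeRing R in
    (A B : Carrier) (n : ℕ) → 2 ≤ n →
    det R n (λ j k → lucasV R A B ∣ toℕ j - toℕ k ∣)
      ≈ ((1# + 1#) * pow R (1# - B) (n ∸ 1) * lucasU R ((1# + 1#) * (1# + B)) (A * A) n
         + ((1# + 1# + 1# + 1#) * (B * B) - A * A) * pow R (1# - B) (n ∸ 2)
           * lucasU R ((1# + 1#) * (1# + B)) (A * A) (n ∸ 1))
corollary1p3 R A B (suc (suc k)) (s≤s (s≤s z≤n)) = begin
  det R (suc (suc k)) (toeplitz (suc (suc k)))  ≈⟨ det-toeplitz≈Δ (suc k) ⟩
  Δ V (suc k)                                   ≈⟨ recurrence-unique R Δ-recurrence F-recurrence Δ₁ Δ₂ k ⟩
  F k                                           ≈⟨ +-cong (*-assoc _ _ _) (*-assoc _ _ _) ⟨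
  _                                             ∎
  where
  open CommutativeRing R
  open LucasToeplitz R A B
  open import Relation.Binary.Reasoning.Setoid setoid
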